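{- Let $G$ be a finite abelian group, $S=\{s,-s,s',-s',s_0\}\subseteq G\setminus\{0\}$ a generating set of $G$ with $|S|=5$, $o(s_0)=2$ and $o(s),o(s')>2$, and $\Gamma=\mathrm{Cay}(G,S)$. For integers $i,j,k$ let $x(i,j,k)=is+js'+ks_0$. Let $D$ be a perfect code of $\Gamma$ and $x(i,j,k)\in D$. Then: (i) $\{x(i,j,k+1),x(i-1,j,k),x(i-2,j,k),x(i-1,j,k+1),x(i-2,j,k+1)\}\cap D=\emptyset$, and $x(i-3,j,k)\in D$ or $x(i-3,j,k+1)\in D$; (ii) $\{x(i,j,k+1),x(i,j-1,k),x(i,j-2,k),x(i,j-1,k+1),x(i,j-2,k+1)\}\cap D=\emptyset$, and $x(i,j-3,k)\in D$ or $x(i,j-3,k+1)\in D$.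
   Context: $\mathrm{Cay}(G,S)$ has vertex set $G$ with $x\sim y$ iff $y-x\in S$. A perfect code is a vertex set $C$ such that every vertex is at distance at most $1$ from exactly one vertex of $C$. $o(x)$ is the order of $x$. -}

module Defs where

open import Level using (Level; _⊔_; suc)
open import Algebra.Bundles using (AbelianGroup)
open import Data.Nat using (ℕ; _≤_; _<_) renaming (suc to sucℕ)
open import Data.Integer using (ℤ; +_; -[1+_]; _+_; _-_)
open import Data.Fin using (Fin)
open import Data.Product using (Σ; ∃; _×_)
open import Data.Sum using (_⊎_)
open import Relation.Nullary using (¬_)
open import Relation.Unary using (Pred)
open import Relation.Binary using (Decidable; _Respects_)

module Cayley {c ℓ : Level} (G : AbelianGroup c ℓ) where
  open AbelianGroup G hiding (_-_)

  open import Algebra.Definitions.RawMonoid rawMonoid using () renaming (_×_ to _·ℕ_) public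

  _·_ : ℤ → Carrier → Carrier
  (+ n) · g = n ·ℕ g
  -[1+ n ] · g = (sucℕ n ·ℕ g) ⁻¹

  _⊖_ : Carrier → Carrier → Carrier
  y ⊖ x = y ∙ x ⁻¹

  -- G is finite (Bishop-finite: decidable equality and a surjective
  -- enumeration by some Fin n, surjective up to ≈)
  IsFinite : Set (c ⊔ ℓ)
  IsFinite = Decidable _≈_ × Σ ℕ (λ n → Σ (Fin n → Carrier) (λ f → ∀ g → ∃ (λ i → f i ≈ g)))

  HasOrder : Carrier → ℕ → Set ℓ
  HasOrder x n = (1 ≤ n) × (n ·ℕ x ≈ ε) × (∀ m → 1 ≤ m → m < n → ¬ (m ·ℕ x ≈ ε))

  OrderGreaterThan : Carrier → ℕ → Set ℓ
  OrderGreaterThan x k = ∀ m → 1 ≤ m → m ≤ k → ¬ (m ·ℕ x ≈ ε)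

  data Generated {s : Level} (S : Pred Carrier s) : Carrier → Set (c ⊔ ℓ ⊔ s) where
    gen-ε   : Generated S ε
    gen-el  : ∀ {g} → S g → Generated S g
    gen-∙   : ∀ {g h} → Generated S g → Generated S h → Generated S (g ∙ h)
    gen-inv : ∀ {g} → Generated S g → Generated S (g ⁻¹)
    gen-≈   : ∀ {g h} → g ≈ h → Generated S g → Generated S h

  GeneratesG : {s : Level} → Pred Carrier s → Set (c ⊔ ℓ ⊔ s)
  GeneratesG S = ∀ g → Generated S g

  S5 : Carrier → Carrier → Carrier → Pred Carrier ℓ
  S5 s s' s₀ g = g ≈ s ⊎ g ≈ s ⁻¹ ⊎ g ≈ s' ⊎ g ≈ s' ⁻¹ ⊎ g ≈ s₀

  Distinct5 : Carrier → Carrier → Carrier → Carrier → Carrier → Set ℓ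
  Distinct5 a b c' d e =
    (a ≉ b) × (a ≉ c') × (a ≉ d) × (a ≉ e) ×
    (b ≉ c') × (b ≉ d) × (b ≉ e) ×
    (c' ≉ d) × (c' ≉ e) ×
    (d ≉ e)

  module _ {s : Level} (S : Pred Carrier s) where
    Adj : Carrier → Carrier → Set s
    Adj x y = S (y ⊖ x)

    Within1 : Carrier → Carrier → Set (ℓ ⊔ s)
    Within1 c v = c ≈ v ⊎ Adj c v

    IsPerfectCode : {d : Level} → Pred Carrier d → Set (c ⊔ ℓ ⊔ s ⊔ d)
    IsPerfectCode C =
      ∀ v → ∃ (λ c₁ → C c₁ × Within1 c₁ v)
          × (∀ c₁ c₂ → C c₁ → C c₂ → Within1 c₁ v → Within1 c₂ v → c₁ ≈ c₂)

  xijk : Carrier → Carrier → Carrier → ℤ → ℤ → ℤ → Carrier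
  xijk s s' s₀ i j k = (i · s) ∙ (j · s') ∙ (k · s₀)

  Lemma3p4 : (d : Level) → Set (c ⊔ ℓ ⊔ suc d)
  Lemma3p4 d = IsFinite →
       (s s' s₀ : Carrier) →
       s ≉ ε → s ⁻¹ ≉ ε → s' ≉ ε → s' ⁻¹ ≉ ε → s₀ ≉ ε →
       Distinct5 s (s ⁻¹) s' (s' ⁻¹) s₀ →
       GeneratesG (S5 s s' s₀) →
       HasOrder s₀ 2 → OrderGreaterThan s 2 → OrderGreaterThan s' 2 →
       (D : Pred Carrier d) → D Respects _≈_ →
       IsPerfectCode (S5 s s' s₀) D →
       (i j k : ℤ) → D (xijk s s' s₀ i j k) →
       ((¬ D (xijk s s' s₀ i j (k + + 1)) × ¬ D (xijk s s' s₀ (i - + 1) j k) × ¬ D (xijk s s' s₀ (i - + 2) j k)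
             × ¬ D (xijk s s' s₀ (i - + 1) j (k + + 1)) × ¬ D (xijk s s' s₀ (i - + 2) j (k + + 1)))
           × (D (xijk s s' s₀ (i - + 3) j k) ⊎ D (xijk s s' s₀ (i - + 3) j (k + + 1))))
          ×
          ((¬ D (xijk s s' s₀ i j (k + + 1)) × ¬ D (xijk s s' s₀ i (j - + 1) k) × ¬ D (xijk s s' s₀ i (j - + 2) k)
             × ¬ D (xijk s s' s₀ i (j - + 1) (k + + 1)) × ¬ D (xijk s s' s₀ i (j - + 2) (k + + 1)))
           × (D (xijk s s' s₀ i (j - + 3) k) ⊎ D (xijk s s' s₀ i (j - + 3) (k + + 1))))

module Submission where

-- Write e, f, t for s, s′, s₀ and x(i,j,k) = i e + j f + k t, where 2t = 0.  A perfect code has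
-- minimum distance 3, so a codeword x excludes codewords at x + t, x − e, x − 2e and x − e + t.
-- It also excludes x − 2e + t: that would force the dominators of x − e + f and x − e + f + t
-- to be x − e + 2f and x − e + 2f + t, two adjacent codewords.  Hence the blocks
-- c + {0, −e, −2e} + {0, t} of the codewords c are pairwise disjoint.  Matching the closed
-- neighbourhood of each codeword with its block gives an injection Ψ : G → G, which is onto as G
-- is finite, so x − 3e lies in a block; only the blocks of x − 3e and x − 3e + t can contain it.

open import Defs
open import Level using (Level; _⊔_)
open import Agda.Builtin.FromNat using (Number; fromNat)
open import Agda.Builtin.FromNeg using (Negative; fromNeg)
open import Algebra.Bundles using (AbelianGroup)
open import Data.Bool using (Bool; true; false; _xor_)
open import Data.Bool.Properties using (xor-assoc; xor-same; xor-identityʳ)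
open import Data.Empty using (⊥-elim)
open import Data.Fin using (Fin; zero; suc; toℕ)
open import Data.Fin.Properties using (injective⇒≤; toℕ-injective; toℕ≤pred[n])
open import Data.Integer as ℤ using (ℤ; +_; -_)
import Data.Integer.Literals as ℤLit
import Data.Integer.Properties as ℤP
open import Data.List using (List; _∷_; length; lookup; map; tabulate; deduplicate)
open import Data.List.Properties using (length-map)
open import Data.List.Relation.Unary.All as All using (All)
open import Data.List.Relation.Unary.All.Properties using (¬Any⇒All¬; map⁺)
open import Data.List.Relation.Unary.AllPairs using (_∷_)
open import Data.List.Relation.Unary.Any as Any using (any?)
open import Data.List.Relation.Unary.Any.Properties using (lookup-index)
open import Data.List.Membership.Propositional.Properties using (∈-lookup)
import Data.List.Membership.Setoid.Properties as Membership
import Data.List.Relation.Unary.Unique.Setoid.Properties as Unique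
open import Data.List.Relation.Unary.Unique.DecSetoid.Properties using (deduplicate-!)
open import Data.Nat as ℕ using (ℕ; _≤_; _∸_; z≤n; s≤s)
import Data.Nat.Literals as ℕLit
import Data.Nat.Properties as ℕP
open import Data.Product as Product using (∃; _×_; _,_; proj₁; proj₂)
open import Data.Sum as Sum using (_⊎_; inj₁; inj₂)
open import Data.Unit.Base using (tt)
open import Function using (_∘_; case_of_)
open import Relation.Binary using (Setoid; DecSetoid; Decidable; _Respects_)
open import Relation.Binary.PropositionalEquality as ≡ using (_≡_; _≢_)
open import Relation.Nullary using (¬_; yes; no; contradiction)
open import Relation.Unary using (Pred)

-- The import of tt is what discharges the trivial constraints of these literal instances.
instance
  ℕ-number : Number ℕ
  ℕ-number = ℕLit.number

  ℤ-number : Number ℤ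
  ℤ-number = ℤLit.number

  ℤ-negative : Negative ℤ
  ℤ-negative = ℤLit.negative

module _ {a ℓ : Level} (S : Setoid a ℓ) where
  open Setoid S
  open import Data.List.Membership.Setoid S using (_∈_)
  open import Data.List.Relation.Unary.Unique.Setoid S using (Unique)
  open import Data.List.Relation.Binary.Subset.Setoid S using (_⊆_)

  Unique-lookup-injective : ∀ {xs} → Unique xs → ∀ i j → lookup xs i ≈ lookup xs j → i ≡ j
  Unique-lookup-injective (_ ∷ _) zero zero _ = ≡.refl
  Unique-lookup-injective (x∉ ∷ _) zero (suc j) eq = contradiction eq (All.lookup x∉ (∈-lookup j))
  Unique-lookup-injective (x∉ ∷ _) (suc i) zero eq = contradiction (sym eq) (All.lookup x∉ (∈-lookup i))
  Unique-lookup-injective (_ ∷ u) (suc i) (suc j) eq = ≡.cong suc (Unique-lookup-injective u i j eq)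

  Unique⇒length≤ : ∀ {xs ys} → Unique xs → xs ⊆ ys → length xs ≤ length ys
  Unique⇒length≤ {xs} {ys} u xs⊆ys = injective⇒≤ position-injective
    where
    position : Fin (length xs) → Fin (length ys)
    position i = Any.index (xs⊆ys (Membership.∈-lookup S xs i))

    lookup-position : ∀ i → lookup xs i ≈ lookup ys (position i)
    lookup-position i = lookup-index (xs⊆ys (Membership.∈-lookup S xs i))

    position-injective : ∀ {i j} → position i ≡ position j → i ≡ j
    position-injective {i} {j} eq = Unique-lookup-injective u i j
      (trans (lookup-position i) (≡.subst (λ p → lookup ys p ≈ lookup xs j) (≡.sym eq) (sym (lookup-position j))))

  module _ (_≟_ : Decidable _≈_) {n : ℕ} (enum : Fin n → Carrier) (enum-onto : ∀ y → ∃ λ i → enum i ≈ y) where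

    private
      decSetoid : DecSetoid a ℓ
      decSetoid = record { isDecEquivalence = record { isEquivalence = isEquivalence ; _≟_ = _≟_ } }

      elements : List Carrier
      elements = deduplicate _≟_ (tabulate enum)

      ∈-elements : ∀ y → y ∈ elements
      ∈-elements y = Membership.∈-deduplicate⁺ S _≟_ (λ x≈y y≈z → trans y≈z (sym x≈y))
        (Membership.∈-resp-≈ S (proj₂ (enum-onto y)) (Membership.∈-tabulate⁺ S (proj₁ (enum-onto y))))

    injective⇒surjective : (f : Carrier → Carrier) → (∀ {x y} → f x ≈ f y → x ≈ y) → ∀ y → ∃ λ x → f x ≈ y
    injective⇒surjective f f-injective y with any? (λ x → f x ≟ y) elements
    ... | yes hit = Any.satisfied hit
    ... | no miss = contradiction (≡.subst (_≤ length elements) (≡.cong ℕ.suc (length-map f elements))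
                                   (Unique⇒length≤ y∷image-unique (λ {x} _ → ∈-elements x)))
                                  (ℕP.<-irrefl ≡.refl)
      where
      y∷image-unique : Unique (y ∷ map f elements)
      y∷image-unique = map⁺ (All.map (λ fx≉y y≈fx → fx≉y (sym y≈fx)) (¬Any⇒All¬ elements miss))
                     ∷ Unique.map⁺ S S f-injective (deduplicate-! decSetoid (tabulate enum))

xor-cancelˡ : ∀ b u → b xor (b xor u) ≡ u
xor-cancelˡ b u = ≡.trans (≡.sym (xor-assoc b b u)) (≡.cong (_xor u) (xor-same b))

xor≡false⇒≡ : ∀ {b u} → b xor u ≡ false → b ≡ u
xor≡false⇒≡ {b} {u} eq =
  ≡.trans (≡.sym (xor-identityʳ b)) (≡.trans (≡.cong (b xor_) (≡.sym eq)) (xor-cancelˡ b u))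

infixl 6 _⊞_

_⊞_ : ℤ × ℤ × ℤ → ℤ × ℤ × ℤ → ℤ × ℤ × ℤ
(i , j , k) ⊞ (a , b , c) = i ℤ.+ a , j ℤ.+ b , k ℤ.+ c

⟦_⟧ : Bool → ℤ
⟦ false ⟧ = 0
⟦ true ⟧ = 1

-- A cell o indexes both a closed neighbour c ∙ nbr o of a codeword c and the point c ∙ blkᶜ o
-- of its block.
Cell : Set
Cell = Fin 3 × Bool

pattern ε̂ = zero , false
pattern ê = suc zero , false
pattern ê⁻¹ = suc (suc zero) , false
pattern t̂ = zero , true
pattern f̂ = suc zero , true
pattern f̂⁻¹ = suc (suc zero) , true

AxisPattern : ∀ {p} → (ℤ → ℤ → ℤ → Set p) → ℤ → ℤ → ℤ → Set p
AxisPattern P i j k =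
  (¬ P i j (k ℤ.+ 1) × ¬ P (i ℤ.- 1) j k × ¬ P (i ℤ.- 2) j k × ¬ P (i ℤ.- 1) j (k ℤ.+ 1) × ¬ P (i ℤ.- 2) j (k ℤ.+ 1))
  × (P (i ℤ.- 3) j k ⊎ P (i ℤ.- 3) j (k ℤ.+ 1))

AxisPattern-resp : ∀ {p q} {P : ℤ → ℤ → ℤ → Set p} {Q : ℤ → ℤ → ℤ → Set q} →
                   (∀ a b c → P a b c → Q a b c) → (∀ a b c → Q a b c → P a b c) →
                   ∀ i j k → AxisPattern P i j k → AxisPattern Q i j k
AxisPattern-resp P⇒Q Q⇒P _ _ _ ((¬P₁ , ¬P₂ , ¬P₃ , ¬P₄ , ¬P₅) , P₆) =
  (¬P₁ ∘ Q⇒P _ _ _ , ¬P₂ ∘ Q⇒P _ _ _ , ¬P₃ ∘ Q⇒P _ _ _ , ¬P₄ ∘ Q⇒P _ _ _ , ¬P₅ ∘ Q⇒P _ _ _) ,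
  Sum.map (P⇒Q _ _ _) (P⇒Q _ _ _) P₆

module _ {γ ℓ : Level} (G : AbelianGroup γ ℓ) where
  open AbelianGroup G hiding (_-_)
  open Cayley G
  open import Algebra.Properties.AbelianGroup G
  open import Algebra.Properties.Monoid.Mult monoid using (×-homo-+)
  open import Algebra.Properties.CommutativeSemigroup commutativeSemigroup using (interchange; x∙yz≈xz∙y)
  open import Relation.Binary.Reasoning.Setoid setoid

  ⊖-· : ∀ m n g → (m ℤ.⊖ n) · g ≈ m ·ℕ g ∙ (n ·ℕ g) ⁻¹
  ⊖-· m ℕ.zero g = sym (trans (∙-congˡ ε⁻¹≈ε) (identityʳ _))
  ⊖-· ℕ.zero (ℕ.suc n) g = sym (identityˡ _)
  ⊖-· (ℕ.suc m) (ℕ.suc n) g = begin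
    (ℕ.suc m ℤ.⊖ ℕ.suc n) · g             ≡⟨ ≡.cong (_· g) (ℤP.[1+m]⊖[1+n]≡m⊖n m n) ⟩
    (m ℤ.⊖ n) · g                         ≈⟨ ⊖-· m n g ⟩
    m ·ℕ g ∙ (n ·ℕ g) ⁻¹                  ≈⟨ sym (xyx⁻¹≈y g _) ⟩
    g ∙ (m ·ℕ g ∙ (n ·ℕ g) ⁻¹) ∙ g ⁻¹      ≈⟨ trans (∙-congʳ (sym (assoc _ _ _))) (assoc _ _ _) ⟩
    g ∙ m ·ℕ g ∙ ((n ·ℕ g) ⁻¹ ∙ g ⁻¹)      ≈⟨ ∙-congˡ (trans (⁻¹-∙-comm _ _) (⁻¹-cong (comm _ _))) ⟩
    g ∙ m ·ℕ g ∙ (g ∙ n ·ℕ g) ⁻¹           ∎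

  ·-homo-+ : ∀ i j g → (i ℤ.+ j) · g ≈ i · g ∙ j · g
  ·-homo-+ (+ m) (+ n) g = ×-homo-+ g m n
  ·-homo-+ (+ m) ℤ.-[1+ n ] g = ⊖-· m (ℕ.suc n) g
  ·-homo-+ ℤ.-[1+ m ] (+ n) g = trans (⊖-· n (ℕ.suc m) g) (comm _ _)
  ·-homo-+ ℤ.-[1+ m ] ℤ.-[1+ n ] g = begin
    (ℕ.suc (ℕ.suc (m ℕ.+ n)) ·ℕ g) ⁻¹        ≡⟨ ≡.cong (λ k → (ℕ.suc k ·ℕ g) ⁻¹) (≡.sym (ℕP.+-suc m n)) ⟩
    ((ℕ.suc m ℕ.+ ℕ.suc n) ·ℕ g) ⁻¹          ≈⟨ ⁻¹-cong (×-homo-+ g (ℕ.suc m) (ℕ.suc n)) ⟩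
    (ℕ.suc m ·ℕ g ∙ ℕ.suc n ·ℕ g) ⁻¹         ≈⟨ sym (⁻¹-∙-comm _ _) ⟩
    (ℕ.suc m ·ℕ g) ⁻¹ ∙ (ℕ.suc n ·ℕ g) ⁻¹    ∎

  xijk-homo : ∀ e f t i j k a b c →
              xijk e f t (i ℤ.+ a) (j ℤ.+ b) (k ℤ.+ c) ≈ xijk e f t i j k ∙ xijk e f t a b c
  xijk-homo e f t i j k a b c = begin
    (i ℤ.+ a) · e ∙ (j ℤ.+ b) · f ∙ (k ℤ.+ c) · t
      ≈⟨ ∙-cong (∙-cong (·-homo-+ i a e) (·-homo-+ j b f)) (·-homo-+ k c t) ⟩
    (i · e ∙ a · e) ∙ (j · f ∙ b · f) ∙ (k · t ∙ c · t)
      ≈⟨ ∙-congʳ (interchange _ _ _ _) ⟩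
    (i · e ∙ j · f) ∙ (a · e ∙ b · f) ∙ (k · t ∙ c · t)
      ≈⟨ interchange _ _ _ _ ⟩
    xijk e f t i j k ∙ xijk e f t a b c
      ∎

  S5-swap : ∀ a b c {g} → S5 a b c g → S5 b a c g
  S5-swap _ _ _ (inj₁ g≈a) = inj₂ (inj₂ (inj₁ g≈a))
  S5-swap _ _ _ (inj₂ (inj₁ g≈a⁻¹)) = inj₂ (inj₂ (inj₂ (inj₁ g≈a⁻¹)))
  S5-swap _ _ _ (inj₂ (inj₂ (inj₁ g≈b))) = inj₁ g≈b
  S5-swap _ _ _ (inj₂ (inj₂ (inj₂ (inj₁ g≈b⁻¹)))) = inj₂ (inj₁ g≈b⁻¹)
  S5-swap _ _ _ (inj₂ (inj₂ (inj₂ (inj₂ g≈c)))) = inj₂ (inj₂ (inj₂ (inj₂ g≈c)))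

  IsPerfectCode-cong : ∀ {s s′ d} {S : Pred Carrier s} {S′ : Pred Carrier s′} {D : Pred Carrier d} →
                       (∀ {g} → S g → S′ g) → (∀ {g} → S′ g → S g) → IsPerfectCode S D → IsPerfectCode S′ D
  IsPerfectCode-cong S⊆S′ S′⊆S code v = Product.map
    (Product.map₂ (Product.map₂ (Sum.map₂ S⊆S′)))
    (λ unique c₁ c₂ c₁∈D c₂∈D w₁ w₂ → unique c₁ c₂ c₁∈D c₂∈D (Sum.map₂ S′⊆S w₁) (Sum.map₂ S′⊆S w₂))
    (code v)

  module PerfectCode {s d : Level} (S : Pred Carrier s) (S-resp : S Respects _≈_) (S-⁻¹ : ∀ {g} → S g → S (g ⁻¹))
                     (D : Pred Carrier d) (code : IsPerfectCode S D) where

    Ball₁ : Carrier → Set (ℓ ⊔ s)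
    Ball₁ g = g ≈ ε ⊎ S g

    Ball₁-⁻¹ : ∀ {g} → Ball₁ g → Ball₁ (g ⁻¹)
    Ball₁-⁻¹ (inj₁ g≈ε) = inj₁ (trans (⁻¹-cong g≈ε) ε⁻¹≈ε)
    Ball₁-⁻¹ (inj₂ g∈S) = inj₂ (S-⁻¹ g∈S)

    Ball₁⇒Within1 : ∀ {c g v} → Ball₁ g → c ∙ g ≈ v → Within1 S c v
    Ball₁⇒Within1 {c} (inj₁ g≈ε) cg≈v = inj₁ (trans (sym (trans (∙-congˡ g≈ε) (identityʳ c))) cg≈v)
    Ball₁⇒Within1 {c} {g} (inj₂ g∈S) cg≈v = inj₂ (S-resp (trans (sym (xyx⁻¹≈y c g)) (∙-congʳ cg≈v)) g∈S)

    codewords-apart : ∀ {c g h} → D c → D (c ∙ g ∙ h) → Ball₁ g → Ball₁ h → g ∙ h ≈ ε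
    codewords-apart {c} {g} {h} c∈D c′∈D g∈B h∈B = sym (∙-cancelˡ c ε (g ∙ h) (begin
      c ∙ ε        ≈⟨ identityʳ c ⟩
      c            ≈⟨ proj₂ (code (c ∙ g)) _ _ c∈D c′∈D (Ball₁⇒Within1 g∈B refl)
                                                     (Ball₁⇒Within1 (Ball₁-⁻¹ h∈B) back) ⟩
      c ∙ g ∙ h    ≈⟨ assoc c g h ⟩
      c ∙ (g ∙ h)  ∎))
      where
      back : c ∙ g ∙ h ∙ h ⁻¹ ≈ c ∙ g
      back = trans (assoc _ h _) (trans (∙-congˡ (inverseʳ h)) (identityʳ _))

    dominated : ∀ v → ∃ λ c → D c × ∃ λ g → Ball₁ g × c ≈ v ∙ g
    dominated v with proj₁ (code v)
    ... | c , c∈D , inj₁ c≈v = c , c∈D , ε , inj₁ refl , trans c≈v (sym (identityʳ v))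
    ... | c , c∈D , inj₂ v⊖c∈S = c , c∈D , (v ⊖ c) ⁻¹ , inj₂ (S-⁻¹ v⊖c∈S) , sym (begin
      v ∙ (v ∙ c ⁻¹) ⁻¹   ≈⟨ ∙-congˡ (⁻¹-anti-homo‿- v c) ⟩
      v ∙ (c ∙ v ⁻¹)      ≈⟨ sym (assoc v c _) ⟩
      v ∙ c ∙ v ⁻¹        ≈⟨ xyx⁻¹≈y v c ⟩
      c                   ∎)

  module S5Code (e f t : Carrier) (o[e]>2 : OrderGreaterThan e 2) (f≉ε : f ≉ ε) (o[t]≡2 : HasOrder t 2)
              (e≉f : e ≉ f) (e≉f⁻¹ : e ≉ f ⁻¹) (e≉t : e ≉ t) (f≉t : f ≉ t)
              {d : Level} (D : Pred Carrier d) (D-resp : D Respects _≈_) (code : IsPerfectCode (S5 e f t) D) where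

    e≉ε : e ≉ ε
    e≉ε e≈ε = o[e]>2 1 (s≤s z≤n) (s≤s z≤n) (trans (identityʳ e) e≈ε)

    e∙e≉ε : e ∙ e ≉ ε
    e∙e≉ε e∙e≈ε = o[e]>2 2 (s≤s z≤n) ℕP.≤-refl (trans (∙-congˡ (identityʳ e)) e∙e≈ε)

    t≉ε : t ≉ ε
    t≉ε t≈ε = proj₂ (proj₂ o[t]≡2) 1 (s≤s z≤n) (s≤s (s≤s z≤n)) (trans (identityʳ t) t≈ε)

    2t≈ε : 2 ·ℕ t ≈ ε
    2t≈ε = proj₁ (proj₂ o[t]≡2)

    t⁻¹≈t : t ⁻¹ ≈ t
    t⁻¹≈t = sym (inverseˡ-unique t t (trans (∙-congˡ (sym (identityʳ t))) 2t≈ε))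

    S5-resp : S5 e f t Respects _≈_
    S5-resp {g} {h} g≈h = Sum.map moved (Sum.map moved (Sum.map moved (Sum.map moved moved)))
      where
      moved : ∀ {x} → g ≈ x → h ≈ x
      moved = trans (sym g≈h)

    S5-⁻¹ : ∀ {g} → S5 e f t g → S5 e f t (g ⁻¹)
    S5-⁻¹ (inj₁ g≈e) = inj₂ (inj₁ (⁻¹-cong g≈e))
    S5-⁻¹ (inj₂ (inj₁ g≈e⁻¹)) = inj₁ (trans (⁻¹-cong g≈e⁻¹) (⁻¹-involutive e))
    S5-⁻¹ (inj₂ (inj₂ (inj₁ g≈f))) = inj₂ (inj₂ (inj₂ (inj₁ (⁻¹-cong g≈f))))
    S5-⁻¹ (inj₂ (inj₂ (inj₂ (inj₁ g≈f⁻¹)))) = inj₂ (inj₂ (inj₁ (trans (⁻¹-cong g≈f⁻¹) (⁻¹-involutive f))))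
    S5-⁻¹ (inj₂ (inj₂ (inj₂ (inj₂ g≈t)))) = inj₂ (inj₂ (inj₂ (inj₂ (trans (⁻¹-cong g≈t) t⁻¹≈t))))

    open PerfectCode (S5 e f t) S5-resp S5-⁻¹ D code

    nbr : Cell → Carrier
    nbr ε̂ = ε
    nbr ê = e
    nbr ê⁻¹ = e ⁻¹
    nbr t̂ = t
    nbr f̂ = f
    nbr f̂⁻¹ = f ⁻¹

    nbr∈Ball₁ : ∀ o → Ball₁ (nbr o)
    nbr∈Ball₁ ε̂ = inj₁ refl
    nbr∈Ball₁ ê = inj₂ (inj₁ refl)
    nbr∈Ball₁ ê⁻¹ = inj₂ (inj₂ (inj₁ refl))
    nbr∈Ball₁ t̂ = inj₂ (inj₂ (inj₂ (inj₂ (inj₂ refl))))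
    nbr∈Ball₁ f̂ = inj₂ (inj₂ (inj₂ (inj₁ refl)))
    nbr∈Ball₁ f̂⁻¹ = inj₂ (inj₂ (inj₂ (inj₂ (inj₁ refl))))

    Ball₁⇒nbr : ∀ {g} → Ball₁ g → ∃ λ o → g ≈ nbr o
    Ball₁⇒nbr (inj₁ g≈ε) = ε̂ , g≈ε
    Ball₁⇒nbr (inj₂ (inj₁ g≈e)) = ê , g≈e
    Ball₁⇒nbr (inj₂ (inj₂ (inj₁ g≈e⁻¹))) = ê⁻¹ , g≈e⁻¹
    Ball₁⇒nbr (inj₂ (inj₂ (inj₂ (inj₁ g≈f)))) = f̂ , g≈f
    Ball₁⇒nbr (inj₂ (inj₂ (inj₂ (inj₂ (inj₁ g≈f⁻¹))))) = f̂⁻¹ , g≈f⁻¹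
    Ball₁⇒nbr (inj₂ (inj₂ (inj₂ (inj₂ (inj₂ g≈t))))) = t̂ , g≈t

    record Cover (v : Carrier) : Set (γ ⊔ ℓ ⊔ d) where
      field
        cell : Cell
        codeword : Carrier
        codeword∈D : D codeword
        codeword≈ : codeword ≈ v ∙ nbr cell

    covered : ∀ v → Cover v
    covered v with dominated v
    ... | c , c∈D , g , g∈B , c≈vg with Ball₁⇒nbr g∈B
    ... | o , g≈o = record { cell = o ; codeword = c ; codeword∈D = c∈D ; codeword≈ = trans c≈vg (∙-congˡ g≈o) }

    ⟨_⟩ : ℤ × ℤ × ℤ → Carrier
    ⟨ i , j , k ⟩ = xijk e f t i j k

    ⟨⟩-homo : ∀ p q → ⟨ p ⊞ q ⟩ ≈ ⟨ p ⟩ ∙ ⟨ q ⟩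
    ⟨⟩-homo (i , j , k) (a , b , c) = xijk-homo e f t i j k a b c

    ⟨⟩-period : ∀ i j k → ⟨ i , j , k ℤ.+ 2 ⟩ ≈ ⟨ i , j , k ⟩
    ⟨⟩-period i j k = ∙-congˡ (trans (·-homo-+ k 2 t) (trans (∙-congˡ 2t≈ε) (identityʳ _)))

    δ : Cell → ℤ × ℤ × ℤ
    δ ε̂ = 0 , 0 , 0
    δ ê = 1 , 0 , 0
    δ ê⁻¹ = -1 , 0 , 0
    δ t̂ = 0 , 0 , 1
    δ f̂ = 0 , 1 , 0
    δ f̂⁻¹ = 0 , -1 , 0

    ⟨δ⟩ : ∀ o → ⟨ δ o ⟩ ≈ nbr o
    ⟨δ⟩ ε̂ = trans (identityʳ _) (identityʳ ε)
    ⟨δ⟩ ê = trans (identityʳ _) (trans (identityʳ _) (identityʳ e))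
    ⟨δ⟩ ê⁻¹ = trans (identityʳ _) (trans (identityʳ _) (⁻¹-cong (identityʳ e)))
    ⟨δ⟩ t̂ = trans (∙-congʳ (identityˡ ε)) (trans (identityˡ _) (identityʳ t))
    ⟨δ⟩ f̂ = trans (identityʳ _) (trans (identityˡ _) (identityʳ f))
    ⟨δ⟩ f̂⁻¹ = trans (identityʳ _) (trans (identityˡ _) (⁻¹-cong (identityʳ f)))

    ⊞δ : ∀ x p o → x ∙ ⟨ p ⊞ δ o ⟩ ≈ x ∙ ⟨ p ⟩ ∙ nbr o
    ⊞δ x p o = trans (∙-congˡ (trans (⟨⟩-homo p (δ o)) (∙-congˡ (⟨δ⟩ o)))) (sym (assoc _ _ _))

    at-origin : ∀ {x} → D x → D (x ∙ ⟨ 0 , 0 , 0 ⟩)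
    at-origin {x} = D-resp (sym (trans (∙-congˡ (⟨δ⟩ ε̂)) (identityʳ x)))

    covered-at : ∀ x p → ∃ λ o → D (x ∙ ⟨ p ⊞ δ o ⟩)
    covered-at x p = cell , D-resp (trans codeword≈ (sym (⊞δ x p cell))) codeword∈D
      where open Cover (covered (x ∙ ⟨ p ⟩))

    apart-at : ∀ x p o o′ → D (x ∙ ⟨ p ⟩) → D (x ∙ ⟨ p ⊞ δ o ⊞ δ o′ ⟩) → nbr o ≈ nbr o′ ⁻¹
    apart-at x p o o′ p∈D q∈D = inverseˡ-unique _ _ (codewords-apart p∈D q∈D′ (nbr∈Ball₁ o) (nbr∈Ball₁ o′))
      where
      q∈D′ : D (x ∙ ⟨ p ⟩ ∙ nbr o ∙ nbr o′)
      q∈D′ = D-resp (trans (⊞δ x (p ⊞ δ o) o′) (∙-congʳ (⊞δ x p o))) q∈D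

    t-2e-gap : ∀ {x} → D x → ¬ D (x ∙ ⟨ -2 , 0 , 1 ⟩)
    t-2e-gap {x} x∈D y∈D = t≉ε (trans (apart-at x (-1 , 2 , 0) t̂ ε̂ above-u above-u+t) ε⁻¹≈ε)
      where
      origin : D (x ∙ ⟨ 0 , 0 , 0 ⟩)
      origin = at-origin x∈D

      above-u : D (x ∙ ⟨ -1 , 2 , 0 ⟩)
      above-u with covered-at x (-1 , 1 , 0)
      ... | ε̂ , c∈D = ⊥-elim (e≉f (⁻¹-injective (apart-at x (0 , 0 , 0) ê⁻¹ f̂ origin c∈D)))
      ... | ê , c∈D = ⊥-elim (f≉ε (trans (apart-at x (0 , 0 , 0) f̂ ε̂ origin c∈D) ε⁻¹≈ε))
      ... | ê⁻¹ , c∈D = ⊥-elim (f≉t (⁻¹-injective (apart-at x (-2 , 1 , 0) f̂⁻¹ t̂ c∈D y∈D)))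
      ... | t̂ , c∈D = ⊥-elim (e≉f⁻¹ (apart-at x (-2 , 0 , 1) ê f̂ y∈D c∈D))
      ... | f̂ , c∈D = c∈D
      ... | f̂⁻¹ , c∈D = ⊥-elim (e≉ε (⁻¹-injective (apart-at x (0 , 0 , 0) ê⁻¹ ε̂ origin c∈D)))

      above-u+t : D (x ∙ ⟨ -1 , 2 , 1 ⟩)
      above-u+t with covered-at x (-1 , 1 , 1)
      ... | ε̂ , c∈D = ⊥-elim (e≉f⁻¹ (apart-at x (-2 , 0 , 1) ê f̂ y∈D c∈D))
      ... | ê , c∈D = ⊥-elim (f≉t (trans (apart-at x (0 , 0 , 0) f̂ t̂ origin c∈D) t⁻¹≈t))
      ... | ê⁻¹ , c∈D = ⊥-elim (f≉ε (trans (apart-at x (-2 , 0 , 1) f̂ ε̂ y∈D c∈D) ε⁻¹≈ε))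
      ... | t̂ , c∈D = ⊥-elim (e≉f (⁻¹-injective
              (apart-at x (0 , 0 , 0) ê⁻¹ f̂ origin (D-resp (∙-congˡ (⟨⟩-period -1 1 0)) c∈D))))
      ... | f̂ , c∈D = c∈D
      ... | f̂⁻¹ , c∈D = ⊥-elim (e≉ε (trans (apart-at x (-2 , 0 , 1) ê ε̂ y∈D c∈D) ε⁻¹≈ε))

    blk : ℕ → Bool → Carrier
    blk m b = ⟨ - + m , 0 , ⟦ b ⟧ ⟩

    block-gap : ∀ {z} m b → D z → D (z ∙ blk m b) → m ≤ 2 → (m , b) ≡ (0 , false)
    block-gap 0 false _ _ _ = ≡.refl
    block-gap 0 true z∈D y∈D _ = ⊥-elim (t≉ε (trans (apart-at _ (0 , 0 , 0) t̂ ε̂ (at-origin z∈D) y∈D) ε⁻¹≈ε))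
    block-gap 1 false z∈D y∈D _ = ⊥-elim (e≉ε (⁻¹-injective (apart-at _ (0 , 0 , 0) ê⁻¹ ε̂ (at-origin z∈D) y∈D)))
    block-gap 1 true z∈D y∈D _ = ⊥-elim (e≉t (⁻¹-injective (apart-at _ (0 , 0 , 0) ê⁻¹ t̂ (at-origin z∈D) y∈D)))
    block-gap 2 false z∈D y∈D _ = ⊥-elim (e∙e≉ε (trans (∙-congˡ (sym e⁻¹≈e)) (inverseʳ e)))
      where
      e⁻¹≈e : e ⁻¹ ≈ e
      e⁻¹≈e = trans (apart-at _ (0 , 0 , 0) ê⁻¹ ê⁻¹ (at-origin z∈D) y∈D) (⁻¹-involutive e)
    block-gap 2 true z∈D y∈D _ = ⊥-elim (t-2e-gap z∈D y∈D)
    block-gap (ℕ.suc (ℕ.suc (ℕ.suc _))) _ _ _ (s≤s (s≤s ()))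

    ⟨⟩-xor : ∀ i j b u → ⟨ i , j , ⟦ b xor u ⟧ ⟩ ≈ ⟨ i , j , ⟦ b ⟧ ℤ.+ ⟦ u ⟧ ⟩
    ⟨⟩-xor i j false false = refl
    ⟨⟩-xor i j false true = refl
    ⟨⟩-xor i j true false = refl
    ⟨⟩-xor i j true true = sym (⟨⟩-period i j 0)

    blk-homo : ∀ m n b u → blk (m ℕ.+ n) (b xor u) ≈ blk m b ∙ blk n u
    blk-homo m n b u = begin
      ⟨ - + (m ℕ.+ n) , 0 , ⟦ b xor u ⟧ ⟩          ≈⟨ ⟨⟩-xor (- + (m ℕ.+ n)) 0 b u ⟩
      ⟨ - + (m ℕ.+ n) , 0 , ⟦ b ⟧ ℤ.+ ⟦ u ⟧ ⟩      ≡⟨ ≡.cong (λ i → ⟨ i , 0 , ⟦ b ⟧ ℤ.+ ⟦ u ⟧ ⟩) -m-n ⟩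
      ⟨ - + m ℤ.+ - + n , 0 , ⟦ b ⟧ ℤ.+ ⟦ u ⟧ ⟩    ≈⟨ ⟨⟩-homo (- + m , 0 , ⟦ b ⟧) (- + n , 0 , ⟦ u ⟧) ⟩
      blk m b ∙ blk n u                            ∎
      where
      -m-n : - + (m ℕ.+ n) ≡ - + m ℤ.+ - + n
      -m-n = ≡.trans (≡.cong -_ (ℤP.pos-+ m n)) (ℤP.neg-distrib-+ (+ m) (+ n))

    blk-shift : ∀ {c c′} m m′ b b′ → m ≤ m′ → c ∙ blk m b ≈ c′ ∙ blk m′ b′ → c ≈ c′ ∙ blk (m′ ∸ m) (b xor b′)
    blk-shift {c} {c′} m m′ b b′ m≤m′ eq = ∙-cancelʳ (blk m b) c _ (begin
      c ∙ blk m b                   ≈⟨ eq ⟩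
      c′ ∙ blk m′ b′                ≡⟨ ≡.cong₂ (λ k x → c′ ∙ blk k x) m′≡m+n b′≡b⊕u ⟩
      c′ ∙ blk (m ℕ.+ n) (b xor u)  ≈⟨ ∙-congˡ (blk-homo m n b u) ⟩
      c′ ∙ (blk m b ∙ blk n u)      ≈⟨ x∙yz≈xz∙y c′ _ _ ⟩
      c′ ∙ blk n u ∙ blk m b        ∎)
      where
      n : ℕ
      n = m′ ∸ m

      u : Bool
      u = b xor b′

      m′≡m+n : m′ ≡ m ℕ.+ n
      m′≡m+n = ≡.sym (ℕP.m+[n∸m]≡n m≤m′)

      b′≡b⊕u : b′ ≡ b xor u
      b′≡b⊕u = ≡.sym (xor-cancelˡ b b′)

    blocks-disjoint-≤ : ∀ {c c′} m m′ b b′ → D c → D c′ → m ≤ m′ → m′ ≤ 2 →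
                        c ∙ blk m b ≈ c′ ∙ blk m′ b′ → m ≡ m′ × b ≡ b′
    blocks-disjoint-≤ m m′ b b′ c∈D c′∈D m≤m′ m′≤2 eq = ℕP.≤-antisym m≤m′ (ℕP.m∸n≡0⇒m≤n (≡.cong proj₁ gap)) ,
                                                            xor≡false⇒≡ (≡.cong proj₂ gap)
      where
      gap : (m′ ∸ m , b xor b′) ≡ (0 , false)
      gap = block-gap _ _ c′∈D (D-resp (blk-shift m m′ b b′ m≤m′ eq) c∈D) (ℕP.≤-trans (ℕP.m∸n≤m m′ m) m′≤2)

    blocks-disjoint : ∀ {c c′} m m′ b b′ → D c → D c′ → m ≤ 2 → m′ ≤ 2 →
                      c ∙ blk m b ≈ c′ ∙ blk m′ b′ → m ≡ m′ × b ≡ b′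
    blocks-disjoint m m′ b b′ c∈D c′∈D m≤2 m′≤2 eq with ℕP.≤-total m m′
    ... | inj₁ m≤m′ = blocks-disjoint-≤ m m′ b b′ c∈D c′∈D m≤m′ m′≤2 eq
    ... | inj₂ m′≤m = Product.map ≡.sym ≡.sym (blocks-disjoint-≤ m′ m b′ b c′∈D c∈D m′≤m m≤2 (sym eq))

    blkᶜ : Cell → Carrier
    blkᶜ (a , b) = blk (toℕ a) b

    cells-disjoint : ∀ {c c′} o o′ → D c → D c′ → c ∙ blkᶜ o ≈ c′ ∙ blkᶜ o′ → o ≡ o′
    cells-disjoint (a , b) (a′ , b′) c∈D c′∈D eq =
      let toℕa≡toℕa′ , b≡b′ = blocks-disjoint (toℕ a) (toℕ a′) b b′ c∈D c′∈D (toℕ≤pred[n] a) (toℕ≤pred[n] a′) eq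
      in ≡.cong₂ _,_ (toℕ-injective toℕa≡toℕa′) b≡b′

    Ψ : Carrier → Carrier
    Ψ v = codeword ∙ blkᶜ cell
      where open Cover (covered v)

    Ψ-injective : ∀ {v w} → Ψ v ≈ Ψ w → v ≈ w
    Ψ-injective {v} {w} Ψv≈Ψw = ∙-cancelʳ (nbr V.cell) v w (begin
      v ∙ nbr V.cell   ≈⟨ sym V.codeword≈ ⟩
      V.codeword       ≈⟨ same-codeword ⟩
      W.codeword       ≈⟨ W.codeword≈ ⟩
      w ∙ nbr W.cell   ≡⟨ ≡.cong (λ o → w ∙ nbr o) (≡.sym same-cell) ⟩
      w ∙ nbr V.cell   ∎)
      where
      module V = Cover (covered v)
      module W = Cover (covered w)

      same-cell : V.cell ≡ W.cell
      same-cell = cells-disjoint V.cell W.cell V.codeword∈D W.codeword∈D Ψv≈Ψw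

      same-codeword : V.codeword ≈ W.codeword
      same-codeword = ∙-cancelʳ (blkᶜ V.cell) _ _
        (≡.subst (λ o → Ψ v ≈ W.codeword ∙ blkᶜ o) (≡.sym same-cell) Ψv≈Ψw)

    x-3e-owner : ∀ {x c} o → D x → D c → c ∙ blkᶜ o ≈ x ∙ blk 3 false →
                 D (x ∙ blk 3 false) ⊎ D (x ∙ blk 3 true)
    x-3e-owner ε̂ _ c∈D eq = inj₁ (D-resp (blk-shift 0 3 false false z≤n eq) c∈D)
    x-3e-owner t̂ _ c∈D eq = inj₂ (D-resp (blk-shift 0 3 true false z≤n eq) c∈D)
    x-3e-owner (suc zero , b) x∈D c∈D eq =
      case block-gap 2 (b xor false) x∈D (D-resp (blk-shift 1 3 b false (s≤s z≤n) eq) c∈D) ℕP.≤-refl of λ ()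
    x-3e-owner (suc (suc zero) , b) x∈D c∈D eq =
      case block-gap 1 (b xor false) x∈D (D-resp (blk-shift 2 3 b false (s≤s (s≤s z≤n)) eq) c∈D) (s≤s z≤n) of λ ()

    three-step : IsFinite → ∀ {x} → D x → D (x ∙ blk 3 false) ⊎ D (x ∙ blk 3 true)
    three-step (_≟_ , _ , enum , enum-onto) {x} x∈D =
      let v , Ψv≈x-3e = injective⇒surjective setoid _≟_ enum enum-onto Ψ Ψ-injective (x ∙ blk 3 false)
          open Cover (covered v)
      in x-3e-owner cell x∈D codeword∈D Ψv≈x-3e

    axis-pattern : IsFinite → ∀ i j k → D ⟨ i , j , k ⟩ → AxisPattern (λ a b c → D ⟨ a , b , c ⟩) i j k
    axis-pattern fin i j k x∈D =
      ( excluded 0 true  (ℤP.+-identityʳ i) ≡.refl             z≤n        (λ ())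
      , excluded 1 false ≡.refl             (ℤP.+-identityʳ k) (s≤s z≤n)  (λ ())
      , excluded 2 false ≡.refl             (ℤP.+-identityʳ k) ℕP.≤-refl  (λ ())
      , excluded 1 true  ≡.refl             ≡.refl             (s≤s z≤n)  (λ ())
      , excluded 2 true  ≡.refl             ≡.refl             ℕP.≤-refl  (λ ()) )
      , Sum.map (reached 3 false ≡.refl (ℤP.+-identityʳ k)) (reached 3 true ≡.refl ≡.refl) (three-step fin x∈D)
      where
      x : Carrier
      x = ⟨ i , j , k ⟩

      at : ∀ {i′ k′} m b → i ℤ.- + m ≡ i′ → k ℤ.+ ⟦ b ⟧ ≡ k′ → x ∙ blk m b ≈ ⟨ i′ , j , k′ ⟩
      at m b i′≡ k′≡ = trans (sym (⟨⟩-homo (i , j , k) (- + m , 0 , ⟦ b ⟧)))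
                             (reflexive (≡.cong ⟨_⟩ (≡.cong₂ _,_ i′≡ (≡.cong₂ _,_ (ℤP.+-identityʳ j) k′≡))))

      reached : ∀ {i′ k′} m b → i ℤ.- + m ≡ i′ → k ℤ.+ ⟦ b ⟧ ≡ k′ → D (x ∙ blk m b) → D ⟨ i′ , j , k′ ⟩
      reached m b i′≡ k′≡ = D-resp (at m b i′≡ k′≡)

      excluded : ∀ {i′ k′} m b → i ℤ.- + m ≡ i′ → k ℤ.+ ⟦ b ⟧ ≡ k′ → m ≤ 2 → (m , b) ≢ (0 , false) →
                 ¬ D ⟨ i′ , j , k′ ⟩
      excluded m b i′≡ k′≡ m≤2 nontrivial y∈D =
        nontrivial (block-gap m b x∈D (D-resp (sym (at m b i′≡ k′≡)) y∈D) m≤2)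

-- Part (ii) is part (i) with s and s′ exchanged.
lemma3p4 : ∀ {c ℓ d : Level} (G : AbelianGroup c ℓ) → Cayley.Lemma3p4 G d
lemma3p4 G fin s s′ s₀ s≉ε _ s′≉ε _ _ (_ , s≉s′ , s≉s′⁻¹ , s≉s₀ , s⁻¹≉s′ , _ , _ , _ , s′≉s₀ , _) _
         o[s₀]≡2 o[s]>2 o[s′]>2 D D-resp code i j k x∈D =
  First.axis-pattern fin i j k x∈D ,
  AxisPattern-resp (λ a b c → D-resp (sym (swap b a c))) (λ a b c → D-resp (swap b a c))
                   j i k (Second.axis-pattern fin j i k (D-resp (swap i j k) x∈D))
  where
  open AbelianGroup G using (_≈_; sym; comm; ∙-congʳ)
  open Cayley G using (xijk; S5)

  module First = S5Code G s s′ s₀ o[s]>2 s′≉ε o[s₀]≡2 s≉s′ s≉s′⁻¹ s≉s₀ s′≉s₀ D D-resp code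
  module Second = S5Code G s′ s s₀ o[s′]>2 s≉ε o[s₀]≡2 (s≉s′ ∘ sym) (s⁻¹≉s′ ∘ sym) s′≉s₀ s≉s₀ D D-resp
                       (IsPerfectCode-cong G {S = S5 s s′ s₀} (S5-swap G s s′ s₀) (S5-swap G s′ s s₀) code)

  swap : ∀ a b c → xijk s s′ s₀ a b c ≈ xijk s′ s s₀ b a c
  swap a b c = ∙-congʳ (comm _ _)
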